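{- Let $n,q,r,s,t\ge1$, let $\mathcal{F}\subseteq Q(n,r)$ and let $1\le i,j\le n$. Then $|\Delta(\tau_{i,j}(\mathcal{F}))|\le|\Delta(\mathcal{F})|$. Furthermore, if $\mathcal{F}$ is $s$-multisum $t$-intersecting, then so is $\tau_{i,j}(\mathcal{F})$.
   Context: $Q(n,r)$ is the set of vectors in $\{0,1,\dots,q\}^n$ of rank $r$, where the rank is the sum of entries. For vectors, $\mathbf{y}<\mathbf{x}$ means $y_i\le x_i$ for all $i$ with strict inequality for some $i$. The shadow of $\mathbf{x}$ is $\Delta(\mathbf{x})=\{\mathbf{y}<\mathbf{x}: r(\mathbf{y})=r(\mathbf{x})-1\}$ and $\Delta(\mathcal{F})=\bigcup_{\mathbf{x}\in\mathcal{F}}\Delta(\mathbf{x})$. For $\mathbf{x}$ of length $n$, $\tau_{i,j}(\mathbf{x})$ is obtained from $\mathbf{x}$ by exchanging its $i$th and $j$th coordinates if $x_i<x_j$, and $\tau_{i,j}(\mathbf{x})=\mathbf{x}$ otherwise; for a family, $\tau_{i,j}(\mathcal{F})=\{\tau_{i,j}(\mathbf{x}):\mathbf{x}\in\mathcal{F},\tau_{i,j}(\mathbf{x})\notin\mathcal{F}\}\cup\{\mathbf{x}\in\mathcal{F}:\tau_{i,j}(\mathbf{x})\in\mathcal{F}\}$. The multi-$s$-sum intersection of $\mathbf{x},\mathbf{y}$ is $|\mathbf{x}\cap_{m,s}\mathbf{y}|=\sum_{i=1}^n\max\{0,x_i+y_i-s+1\}$; $\mathcal{F}$ is $s$-multisum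 $t$-intersecting if $|\mathbf{x}\cap_{m,s}\mathbf{y}|\ge t$ for any $\mathbf{x},\mathbf{y}\in\mathcal{F}$. -}

module Defs where

open import Data.Nat using (ℕ; zero; suc; _+_; _∸_; _≤_; _≤ᵇ_; _<ᵇ_; _≡ᵇ_)
open import Data.Bool using (Bool; true; false; _∧_; _∨_; not; if_then_else_)
open import Data.Fin using (Fin)
open import Data.List as L using (List; []; _∷_; concatMap; upTo; filter; length)
open import Data.Bool.ListAction using (any)
open import Data.Vec as V using (Vec; []; _∷_; lookup; _[_]≔_; zipWith; foldr)
open import Relation.Binary.PropositionalEquality using (_≡_)
open import Relation.Nullary.Decidable using (Dec; yes; no)
open import Data.Bool using (T)

rank : ∀ {n} → Vec ℕ n → ℕ
rank = V.sum

box : (q n : ℕ) → List (Vec ℕ n)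
box q zero = [] ∷ []
box q (suc n) = concatMap (λ a → L.map (a ∷_) (box q n)) (upTo (suc q))

allᵇ : ∀ {n} → Vec Bool n → Bool
allᵇ = foldr _ _∧_ true

_≤vᵇ_ : ∀ {n} → Vec ℕ n → Vec ℕ n → Bool
y ≤vᵇ x = allᵇ (zipWith _≤ᵇ_ y x)

_≡vᵇ_ : ∀ {n} → Vec ℕ n → Vec ℕ n → Bool
y ≡vᵇ x = allᵇ (zipWith _≡ᵇ_ y x)

_<vᵇ_ : ∀ {n} → Vec ℕ n → Vec ℕ n → Bool
y <vᵇ x = (y ≤vᵇ x) ∧ not (y ≡vᵇ x)

-- A family of vectors in {0,…,q}^n, given by its (decidable) membership predicate.
-- Its members are always required to lie in the box {0,…,q}^n (see InQ below).
Family : ℕ → Set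
Family n = Vec ℕ n → Bool

_∈F_ : ∀ {n} → Vec ℕ n → Family n → Set
x ∈F F = F x ≡ true

InQ : (q r : ℕ) {n : ℕ} → Vec ℕ n → Set
InQ q r x = T (allᵇ (V.map (_≤ᵇ q) x)) Data.Product.× (rank x ≡ r)
  where import Data.Product

_⊆Q[_,_] : ∀ {n} → Family n → ℕ → ℕ → Set
F ⊆Q[ q , r ] = ∀ x → x ∈F F → InQ q r x

card : (q : ℕ) {n : ℕ} → Family n → ℕ
card q {n} G = length (filter (λ x → T? (G x)) (box q n))
  where
  T? : (b : Bool) → Dec (T b)
  T? true = yes _
  T? false = no (λ ())

shadow : (q : ℕ) {n : ℕ} → Family n → Family n
shadow q {n} F y = any (λ x → F x ∧ (y <vᵇ x) ∧ (suc (rank y) ≡ᵇ rank x)) (box q n)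

τ : ∀ {n} → Fin n → Fin n → Vec ℕ n → Vec ℕ n
τ i j x = if lookup x i <ᵇ lookup x j
          then (x [ i ]≔ lookup x j) [ j ]≔ lookup x i
          else x

-- τ_{i,j}(F) = {τ(x) : x ∈ F, τ(x) ∉ F} ∪ {x ∈ F : τ(x) ∈ F}, for F ⊆ {0,…,q}^n
τF : (q : ℕ) {n : ℕ} → Fin n → Fin n → Family n → Family n
τF q {n} i j F z =
  any (λ x → F x ∧ not (F (τ i j x)) ∧ (τ i j x ≡vᵇ z)) (box q n)
  ∨ (F z ∧ F (τ i j z))

-- |x ∩_{m,s} y| = Σ_i max{0, x_i + y_i − s + 1}
multisumInter : ∀ {n} → ℕ → Vec ℕ n → Vec ℕ n → ℕ
multisumInter s x y = V.sum (zipWith (λ a b → suc (a + b) ∸ s) x y)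

MultisumIntersecting : ∀ {n} → ℕ → ℕ → Family n → Set
MultisumIntersecting s t F = ∀ x y → x ∈F F → y ∈F F → t ≤ multisumInter s x y

-- Let swap exchange the coordinates i and j, so that τ(x) is swap(x) when x_i < x_j and x
-- otherwise. Every y in Δ(τ_{i,j}(F)) lies in Δ(F), or else y_j > y_i and swap(y) lies in
-- Δ(F); moreover a y of the first kind is never the swap of one of the second kind, so keeping
-- the first kind and swapping the second injects Δ(τ_{i,j}(F)) into Δ(F). For intersection,
-- swapping both vectors leaves the multisum intersection unchanged, while swapping one of two
-- vectors that are oppositely ordered on {i, j} can only increase it: (a, b) ↦
-- max{0, a + b − s + 1} is a convex function of a + b, hence supermodular.

module Submission where

open import Defs
open import Data.Nat using (ℕ; zero; suc; _+_; _∸_; _≤_; _<_; _≤ᵇ_; _<ᵇ_; _≡ᵇ_; z≤n; s≤s)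
open import Data.Nat.Properties
open import Algebra.Properties.CommutativeSemigroup +-commutativeSemigroup
  using (xy∙z≈zy∙x; xy∙z≈xz∙y; xy∙z≈x∙zy; x∙yz≈y∙xz)
open import Data.Bool using (Bool; true; false; not; T; if_then_else_)
open import Data.Bool.Properties using (T-≡; T-∧; T-∨; T?)
open import Data.Fin using (Fin; zero; suc)
open import Data.Fin.Properties using () renaming (_≟_ to _≟ᶠ_; suc-injective to Fin-suc-injective)
open import Data.List as L using (List; []; _∷_; _++_; concatMap; cartesianProductWith; upTo; filter; length)
open import Data.List.Properties using (length-++-sucʳ)
open import Data.List.Relation.Unary.Any.Properties using (any⁻; any⁺)
import Data.List.Relation.Unary.All as All
open import Data.List.Relation.Unary.AllPairs using ([]; _∷_)
open import Data.List.Relation.Unary.Unique.Propositional using (Unique)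
open import Data.List.Relation.Unary.Unique.Propositional.Properties
  using (cartesianProductWith⁺; upTo⁺; filter⁺)
open import Data.List.Membership.Propositional using (_∈_; find; lose)
open import Data.List.Membership.Propositional.Properties
  using ( ∈-cartesianProductWith⁺; ∈-cartesianProductWith⁻; ∈-upTo⁺; ∈-upTo⁻
        ; ∈-∃++; ∈-++⁻; ∈-++⁺ˡ; ∈-++⁺ʳ; ∈-filter⁺; ∈-filter⁻)
open import Data.List.Relation.Unary.Any using (here; there)
open import Data.Vec using (Vec; []; _∷_; lookup; _[_]≔_; zipWith; sum)
open import Data.Vec.Properties
  using ( lookup∘update; lookup∘update′; []≔-lookup; lookup-zipWith; zipWith-comm
        ; tabulate∘lookup; tabulate-cong; ∷-injective)
import Data.Vec.Relation.Unary.All as VAll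
open import Data.Vec.Relation.Unary.All.Properties using (lookup⁺; lookup⁻)
open import Data.Product using (_×_; _,_; proj₁; proj₂; ∃-syntax)
open import Data.Sum using (_⊎_; inj₁; inj₂)
open import Data.Empty using (⊥-elim)
open import Function using (_∘_)
open import Function.Bundles using (module Equivalence)
open import Relation.Binary.PropositionalEquality
open import Relation.Nullary using (¬_; yes; no; contradiction)
open import Level using (Level)
open import Relation.Unary using (Pred; Decidable)

open Equivalence using (to; from)

private
  variable
    A B C : Set
    ℓ₁ ℓ₂ : Level
    n : ℕ

¬T⇒T-not : ∀ {b} → ¬ T b → T (not b)
¬T⇒T-not {false} _ = _
¬T⇒T-not {true} ¬t = ¬t _

T-not⇒¬T : ∀ {b} → T (not b) → ¬ T b
T-not⇒¬T {false} _ ()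

lookup-ext : (u w : Vec A n) → (∀ k → lookup u k ≡ lookup w k) → u ≡ w
lookup-ext u w eq = trans (sym (tabulate∘lookup u)) (trans (tabulate-cong eq) (tabulate∘lookup w))

allᵇ-zipWith⁻ : (f : A → B → Bool) (y : Vec A n) (x : Vec B n) →
  T (allᵇ (zipWith f y x)) → ∀ k → T (f (lookup y k) (lookup x k))
allᵇ-zipWith⁻ f (a ∷ y) (b ∷ x) h zero = proj₁ (to T-∧ h)
allᵇ-zipWith⁻ f (a ∷ y) (b ∷ x) h (suc k) = allᵇ-zipWith⁻ f y x (proj₂ (to T-∧ h)) k

allᵇ-zipWith⁺ : (f : A → B → Bool) (y : Vec A n) (x : Vec B n) →
  (∀ k → T (f (lookup y k) (lookup x k))) → T (allᵇ (zipWith f y x))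
allᵇ-zipWith⁺ f [] [] h = _
allᵇ-zipWith⁺ f (a ∷ y) (b ∷ x) h = from T-∧ (h zero , allᵇ-zipWith⁺ f y x (h ∘ suc))

_≤ᵛ_ : Vec ℕ n → Vec ℕ n → Set
y ≤ᵛ x = ∀ k → lookup y k ≤ lookup x k

≤vᵇ⇒≤ᵛ : (y x : Vec ℕ n) → T (y ≤vᵇ x) → y ≤ᵛ x
≤vᵇ⇒≤ᵛ y x h k = ≤ᵇ⇒≤ _ _ (allᵇ-zipWith⁻ _≤ᵇ_ y x h k)

≤ᵛ⇒≤vᵇ : (y x : Vec ℕ n) → y ≤ᵛ x → T (y ≤vᵇ x)
≤ᵛ⇒≤vᵇ y x h = allᵇ-zipWith⁺ _≤ᵇ_ y x (λ k → ≤⇒≤ᵇ (h k))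

≡vᵇ⇒≡ : (y x : Vec ℕ n) → T (y ≡vᵇ x) → y ≡ x
≡vᵇ⇒≡ y x h = lookup-ext y x (λ k → ≡ᵇ⇒≡ _ _ (allᵇ-zipWith⁻ _≡ᵇ_ y x h k))

concatMap-map≡cartesianProductWith : (f : A → B → C) (xs : List A) (ys : List B) →
  concatMap (λ a → L.map (f a) ys) xs ≡ cartesianProductWith f xs ys
concatMap-map≡cartesianProductWith f [] ys = refl
concatMap-map≡cartesianProductWith f (x ∷ xs) ys =
  cong (L.map (f x) ys ++_) (concatMap-map≡cartesianProductWith f xs ys)

box-suc : ∀ q n → box q (suc n) ≡ cartesianProductWith _∷_ (upTo (suc q)) (box q n)
box-suc q n = concatMap-map≡cartesianProductWith _∷_ (upTo (suc q)) (box q n)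

∈-box⁺ : ∀ {q} {x : Vec ℕ n} → VAll.All (_≤ q) x → x ∈ box q n
∈-box⁺ VAll.[] = here refl
∈-box⁺ {q = q} (a≤q VAll.∷ x≤q) =
  subst (_ ∈_) (sym (box-suc q _)) (∈-cartesianProductWith⁺ _∷_ (∈-upTo⁺ (s≤s a≤q)) (∈-box⁺ x≤q))

∈-box⁻ : ∀ {q} {x : Vec ℕ n} → x ∈ box q n → VAll.All (_≤ q) x
∈-box⁻ {x = []} _ = VAll.[]
∈-box⁻ {suc n} {q} {a ∷ x} x∈box
  with _ , _ , a∈ , x∈ , refl ←
    ∈-cartesianProductWith⁻ _∷_ (upTo (suc q)) (box q n) (subst (_ ∈_) (box-suc q n) x∈box)
  = ≤-pred (∈-upTo⁻ a∈) VAll.∷ ∈-box⁻ x∈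

box-unique : ∀ q n → Unique (box q n)
box-unique q zero = All.[] ∷ []
box-unique q (suc n) = subst Unique (sym (box-suc q n))
  (cartesianProductWith⁺ _∷_ ∷-injective (upTo⁺ (suc q)) (box-unique q n))

length-≤-injection : {xs ys : List A} (h : A → A) → Unique xs →
  (∀ {x} → x ∈ xs → h x ∈ ys) →
  (∀ {x y} → x ∈ xs → y ∈ xs → h x ≡ h y → x ≡ y) →
  length xs ≤ length ys
length-≤-injection {xs = []} h _ _ _ = z≤n
length-≤-injection {xs = x ∷ xs} h (x∉xs ∷ xs!) into inj
  with ys₁ , ys₂ , refl ← ∈-∃++ (into (here refl)) = begin
    suc (length xs)              ≤⟨ s≤s (length-≤-injection h xs! into′ (λ u v → inj (there u) (there v))) ⟩
    suc (length (ys₁ ++ ys₂))    ≡⟨ length-++-sucʳ ys₁ (h x) ys₂ ⟨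
    length (ys₁ ++ h x ∷ ys₂)    ∎
  where
  open ≤-Reasoning
  into′ : ∀ {v} → v ∈ xs → h v ∈ ys₁ ++ ys₂
  into′ {v} v∈xs with ∈-++⁻ ys₁ (into (there v∈xs))
  ... | inj₁ p = ∈-++⁺ˡ p
  ... | inj₂ (there p) = ∈-++⁺ʳ ys₁ p
  ... | inj₂ (here hv≡hx) = contradiction (sym (inj (there v∈xs) (here refl) hv≡hx)) (All.lookup x∉xs v∈xs)

filter-length-≤-injection : {P : Pred A ℓ₁} {Q : Pred A ℓ₂} (P? : Decidable P) (Q? : Decidable Q)
  {xs : List A} →
  Unique xs → (h : A → A) →
  (∀ {x} → x ∈ xs → P x → h x ∈ xs × Q (h x)) →
  (∀ {x y} → x ∈ xs → y ∈ xs → P x → P y → h x ≡ h y → x ≡ y) →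
  length (filter P? xs) ≤ length (filter Q? xs)
filter-length-≤-injection P? Q? {xs} xs! h into inj =
  length-≤-injection h (filter⁺ P? xs!) into′ inj′
  where
  into′ : ∀ {x} → x ∈ filter P? xs → h x ∈ filter Q? xs
  into′ x∈ with x∈xs , Px ← ∈-filter⁻ P? x∈ = let hx∈ , Qhx = into x∈xs Px in ∈-filter⁺ Q? hx∈ Qhx
  inj′ : ∀ {x y} → x ∈ filter P? xs → y ∈ filter P? xs → h x ≡ h y → x ≡ y
  inj′ x∈ y∈ = let x∈xs , Px = ∈-filter⁻ P? x∈ ; y∈xs , Py = ∈-filter⁻ P? y∈ in inj x∈xs y∈xs Px Py

AgreeOff : Fin n → Fin n → Vec A n → Vec A n → Set
AgreeOff i j u w = ∀ k → k ≢ i → k ≢ j → lookup u k ≡ lookup w k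

coordinate-cases : (P : Fin n → Set) (i j : Fin n) → P i → P j →
  (∀ k → k ≢ i → k ≢ j → P k) → ∀ k → P k
coordinate-cases P i j Pi Pj Pk k with k ≟ᶠ i | k ≟ᶠ j
... | yes refl | _        = Pi
... | no _     | yes refl = Pj
... | no k≢i   | no k≢j   = Pk k k≢i k≢j

swap : Fin n → Fin n → Vec A n → Vec A n
swap i j x = (x [ i ]≔ lookup x j) [ j ]≔ lookup x i

module _ (i j : Fin n) (x : Vec A n) where

  lookup-swap-j : lookup (swap i j x) j ≡ lookup x i
  lookup-swap-j = lookup∘update j (x [ i ]≔ lookup x j) (lookup x i)

  lookup-swap-i : lookup (swap i j x) i ≡ lookup x j
  lookup-swap-i with i ≟ᶠ j
  ... | yes refl = lookup-swap-j
  ... | no i≢j = trans (lookup∘update′ i≢j (x [ i ]≔ lookup x j) (lookup x i)) (lookup∘update i x (lookup x j))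

  lookup-swap-≢ : AgreeOff i j (swap i j x) x
  lookup-swap-≢ k k≢i k≢j =
    trans (lookup∘update′ k≢j (x [ i ]≔ lookup x j) (lookup x i)) (lookup∘update′ k≢i x (lookup x j))

swap-self : (i : Fin n) (x : Vec A n) → swap i i x ≡ x
swap-self i x = trans (cong (λ v → v [ i ]≔ lookup x i) ([]≔-lookup x i)) ([]≔-lookup x i)

swap-pointwise : (R : A → B → Set) (i j : Fin n) {y : Vec A n} {x : Vec B n} →
  (∀ k → R (lookup y k) (lookup x k)) → ∀ k → R (lookup (swap i j y) k) (lookup (swap i j x) k)
swap-pointwise R i j {y} {x} yRx = coordinate-cases _ i j
  (subst₂ R (sym (lookup-swap-i i j y)) (sym (lookup-swap-i i j x)) (yRx j))
  (subst₂ R (sym (lookup-swap-j i j y)) (sym (lookup-swap-j i j x)) (yRx i))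
  (λ k k≢i k≢j → subst₂ R (sym (lookup-swap-≢ i j y k k≢i k≢j)) (sym (lookup-swap-≢ i j x k k≢i k≢j)) (yRx k))

swap-involutive : (i j : Fin n) (x : Vec A n) → swap i j (swap i j x) ≡ x
swap-involutive i j x = lookup-ext _ x (coordinate-cases _ i j
  (trans (lookup-swap-i i j (swap i j x)) (lookup-swap-j i j x))
  (trans (lookup-swap-j i j (swap i j x)) (lookup-swap-i i j x))
  (λ k k≢i k≢j → trans (lookup-swap-≢ i j (swap i j x) k k≢i k≢j) (lookup-swap-≢ i j x k k≢i k≢j)))

swap-mono : (i j : Fin n) {y x : Vec ℕ n} → y ≤ᵛ x → swap i j y ≤ᵛ swap i j x
swap-mono i j {y} {x} = swap-pointwise _≤_ i j {y} {x}

zipWith-swap : (f : A → B → C) (i j : Fin n) (x : Vec A n) (y : Vec B n) →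
  zipWith f (swap i j x) (swap i j y) ≡ swap i j (zipWith f x y)
zipWith-swap f i j x y = lookup-ext _ _ (coordinate-cases _ i j
  (agree (lookup-swap-i i j x) (lookup-swap-i i j y) (lookup-swap-i i j z))
  (agree (lookup-swap-j i j x) (lookup-swap-j i j y) (lookup-swap-j i j z))
  (λ k k≢i k≢j → agree (lookup-swap-≢ i j x k k≢i k≢j) (lookup-swap-≢ i j y k k≢i k≢j)
                       (lookup-swap-≢ i j z k k≢i k≢j)))
  where
  open ≡-Reasoning
  z = zipWith f x y
  agree : ∀ {k l} → lookup (swap i j x) k ≡ lookup x l → lookup (swap i j y) k ≡ lookup y l →
    lookup (swap i j z) k ≡ lookup z l → lookup (zipWith f (swap i j x) (swap i j y)) k ≡ lookup (swap i j z) k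
  agree {k} {l} ex ey ez = begin
    lookup (zipWith f (swap i j x) (swap i j y)) k     ≡⟨ lookup-zipWith f k (swap i j x) (swap i j y) ⟩
    f (lookup (swap i j x) k) (lookup (swap i j y) k)  ≡⟨ cong₂ f ex ey ⟩
    f (lookup x l) (lookup y l)                        ≡⟨ lookup-zipWith f l x y ⟨
    lookup z l                                         ≡⟨ ez ⟨
    lookup (swap i j z) k                              ∎

sum-agreeOff₁ : (u w : Vec ℕ n) (j : Fin n) → (∀ k → k ≢ j → lookup u k ≡ lookup w k) →
  sum u + lookup w j ≡ sum w + lookup u j
sum-agreeOff₁ (a ∷ u) (b ∷ w) zero agree
  rewrite lookup-ext u w (λ k → agree (suc k) λ ()) = xy∙z≈zy∙x a (sum w) b
sum-agreeOff₁ (a ∷ u) (b ∷ w) (suc j) agree rewrite agree zero (λ ()) = begin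
  b + sum u + lookup w j    ≡⟨ +-assoc b (sum u) _ ⟩
  b + (sum u + lookup w j)  ≡⟨ cong (b +_) (sum-agreeOff₁ u w j agree-tail) ⟩
  b + (sum w + lookup u j)  ≡⟨ +-assoc b (sum w) _ ⟨
  b + sum w + lookup u j    ∎
  where
  open ≡-Reasoning
  agree-tail : ∀ k → k ≢ j → lookup u k ≡ lookup w k
  agree-tail k k≢j = agree (suc k) (k≢j ∘ Fin-suc-injective)

sum-agreeOff₂ : (u w : Vec ℕ n) {i j : Fin n} → i ≢ j → AgreeOff i j u w →
  sum u + (lookup w i + lookup w j) ≡ sum w + (lookup u i + lookup u j)
sum-agreeOff₂ u w {i} {j} i≢j agree = begin
  sum u + (wᵢ + wⱼ)  ≡⟨ +-assoc (sum u) wᵢ wⱼ ⟨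
  sum u + wᵢ + wⱼ    ≡⟨ cong (_+ wⱼ) u~m ⟩
  sum m + uᵢ + wⱼ    ≡⟨ xy∙z≈xz∙y (sum m) uᵢ wⱼ ⟩
  sum m + wⱼ + uᵢ    ≡⟨ cong (_+ uᵢ) m~w ⟩
  sum w + uⱼ + uᵢ    ≡⟨ xy∙z≈x∙zy (sum w) uⱼ uᵢ ⟩
  sum w + (uᵢ + uⱼ)  ∎
  where
  open ≡-Reasoning
  uᵢ = lookup u i
  uⱼ = lookup u j
  wᵢ = lookup w i
  wⱼ = lookup w j
  m = u [ i ]≔ wᵢ
  u~m : sum u + wᵢ ≡ sum m + uᵢ
  u~m = subst (λ c → sum u + c ≡ sum m + uᵢ) (lookup∘update i u wᵢ)
    (sum-agreeOff₁ u m i (λ k k≢i → sym (lookup∘update′ k≢i u wᵢ)))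
  m-agree : ∀ k → k ≢ j → lookup m k ≡ lookup w k
  m-agree k k≢j with k ≟ᶠ i
  ... | yes refl = lookup∘update i u wᵢ
  ... | no k≢i = trans (lookup∘update′ k≢i u wᵢ) (agree k k≢i k≢j)
  m~w : sum m + wⱼ ≡ sum w + uⱼ
  m~w = subst (λ c → sum m + wⱼ ≡ sum w + c) (lookup∘update′ (i≢j ∘ sym) u wᵢ) (sum-agreeOff₁ m w j m-agree)

sum-mono-agreeOff₂ : (u w : Vec ℕ n) {i j : Fin n} → i ≢ j → AgreeOff i j u w →
  lookup u i + lookup u j ≤ lookup w i + lookup w j → sum u ≤ sum w
sum-mono-agreeOff₂ u w {i} {j} i≢j agree uᵢⱼ≤wᵢⱼ = +-cancelʳ-≤ (lookup w i + lookup w j) (sum u) (sum w) (begin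
  sum u + (lookup w i + lookup w j)  ≡⟨ sum-agreeOff₂ u w i≢j agree ⟩
  sum w + (lookup u i + lookup u j)  ≤⟨ +-monoʳ-≤ (sum w) uᵢⱼ≤wᵢⱼ ⟩
  sum w + (lookup w i + lookup w j)  ∎)
  where open ≤-Reasoning

sum-swap : (i j : Fin n) (u : Vec ℕ n) → sum (swap i j u) ≡ sum u
sum-swap i j u with i ≟ᶠ j
... | yes refl = cong sum (swap-self i u)
... | no i≢j = +-cancelʳ-≡ (uᵢ + uⱼ) (sum (swap i j u)) (sum u) (begin
  sum (swap i j u) + (uᵢ + uⱼ)                             ≡⟨ sum-agreeOff₂ (swap i j u) u i≢j (lookup-swap-≢ i j u) ⟩
  sum u + (lookup (swap i j u) i + lookup (swap i j u) j)  ≡⟨ cong (sum u +_) swapped-pair ⟩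
  sum u + (uᵢ + uⱼ)                                        ∎)
  where
  open ≡-Reasoning
  uᵢ = lookup u i
  uⱼ = lookup u j
  swapped-pair : lookup (swap i j u) i + lookup (swap i j u) j ≡ uᵢ + uⱼ
  swapped-pair = trans (cong₂ _+_ (lookup-swap-i i j u) (lookup-swap-j i j u)) (+-comm uⱼ uᵢ)

τ-cases : (i j : Fin n) (x : Vec ℕ n) →
  (lookup x i < lookup x j × τ i j x ≡ swap i j x) ⊎ (lookup x j ≤ lookup x i × τ i j x ≡ x)
τ-cases i j x with lookup x i <ᵇ lookup x j in eq
... | true = inj₁ (<ᵇ⇒< _ _ (from T-≡ eq) , refl)
... | false = inj₂ (≮⇒≥ (λ lt → subst T eq (<⇒<ᵇ lt)) , refl)

τ-swaps : (i j : Fin n) {x : Vec ℕ n} → lookup x i < lookup x j → τ i j x ≡ swap i j x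
τ-swaps i j {x} xᵢ<xⱼ with τ-cases i j x
... | inj₁ (_ , τx≡swap) = τx≡swap
... | inj₂ (xⱼ≤xᵢ , _) = contradiction xⱼ≤xᵢ (<⇒≱ xᵢ<xⱼ)

τ-elim : (P : Vec ℕ n → Set) (i j : Fin n) {x : Vec ℕ n} → P x → P (swap i j x) → P (τ i j x)
τ-elim P i j {x} Px Pswap with τ-cases i j x
... | inj₁ (_ , τx≡swap) = subst P (sym τx≡swap) Pswap
... | inj₂ (_ , τx≡x) = subst P (sym τx≡x) Px

-- y ∈ Δ(x); the requirement y ≠ x in Defs.shadow follows from the ranks.
record _⋖_ (y x : Vec ℕ n) : Set where
  constructor covered
  field
    below : y ≤ᵛ x
    rank-suc : suc (rank y) ≡ rank x

swap-⋖ : (i j : Fin n) {y x : Vec ℕ n} → y ⋖ x → swap i j y ⋖ swap i j x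
swap-⋖ i j {y} {x} (covered y≤x rk) = covered
  (swap-mono i j {y} {x} y≤x) (trans (cong suc (sum-swap i j y)) (trans rk (sym (sum-swap i j x))))

swap-⋖-opposite : (i j : Fin n) {y z : Vec ℕ n} → y ⋖ z →
  lookup y i ≤ lookup y j → lookup z j ≤ lookup z i → swap i j y ⋖ z
swap-⋖-opposite i j {y} {z} (covered y≤z rk) yᵢ≤yⱼ zⱼ≤zᵢ =
  covered swap-y≤z (trans (cong suc (sum-swap i j y)) rk)
  where
  swap-y≤z : swap i j y ≤ᵛ z
  swap-y≤z = coordinate-cases _ i j
    (subst (_≤ lookup z i) (sym (lookup-swap-i i j y)) (≤-trans (y≤z j) zⱼ≤zᵢ))
    (subst (_≤ lookup z j) (sym (lookup-swap-j i j y)) (≤-trans yᵢ≤yⱼ (y≤z j)))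
    (λ k k≢i k≢j → subst (_≤ lookup z k) (sym (lookup-swap-≢ i j y k k≢i k≢j)) (y≤z k))

module _ (q : ℕ) {n : ℕ} where

  swap-∈-box : (i j : Fin n) {x : Vec ℕ n} → x ∈ box q n → swap i j x ∈ box q n
  swap-∈-box i j {x} x∈box =
    ∈-box⁺ (lookup⁻ (swap-pointwise (λ a _ → a ≤ q) i j {x} {x} (lookup⁺ (∈-box⁻ x∈box))))

  shadow⁻ : (F : Family n) {y : Vec ℕ n} → T (shadow q F y) → ∃[ x ] x ∈ box q n × T (F x) × y ⋖ x
  shadow⁻ F {y} h with x , x∈box , p ← find (any⁻ _ (box q n) h) =
    let Fx , y<x∧rk = to T-∧ p ; y<x , rk = to T-∧ y<x∧rk
    in x , x∈box , Fx , covered (≤vᵇ⇒≤ᵛ y x (proj₁ (to T-∧ y<x))) (≡ᵇ⇒≡ _ _ rk)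

  shadow⁺ : (F : Family n) {y x : Vec ℕ n} → x ∈ box q n → T (F x) → y ⋖ x → T (shadow q F y)
  shadow⁺ F {y} {x} x∈box Fx (covered y≤x rk) =
    any⁺ _ (lose x∈box (from T-∧ (Fx , from T-∧ (from T-∧ (≤ᵛ⇒≤vᵇ y x y≤x , y≢x) , ≡⇒≡ᵇ _ _ rk))))
    where
    y≢x : T (not (y ≡vᵇ x))
    y≢x = ¬T⇒T-not (λ y≡x → 1+n≢n (trans rk (cong rank (sym (≡vᵇ⇒≡ y x y≡x)))))

  τF⁻ : (i j : Fin n) (F : Family n) {z : Vec ℕ n} → T (τF q i j F z) →
    (∃[ x ] x ∈ box q n × T (F x) × lookup x i < lookup x j × z ≡ swap i j x)
    ⊎ (T (F z) × T (F (τ i j z)))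
  τF⁻ i j F {z} h with to T-∨ h
  ... | inj₂ p = inj₂ (to T-∧ p)
  ... | inj₁ p with x , x∈box , Fx∧rest ← find (any⁻ _ (box q n) p)
               with Fx , Fτx∉∧τx≡z ← to T-∧ Fx∧rest
               with Fτx∉ , τx≡z ← to T-∧ Fτx∉∧τx≡z
               with τ-cases i j x
  ... | inj₂ (_ , τx≡x) = contradiction (subst (T ∘ F) (sym τx≡x) Fx) (T-not⇒¬T Fτx∉)
  ... | inj₁ (xᵢ<xⱼ , τx≡swap) = inj₁ (x , x∈box , Fx , xᵢ<xⱼ , trans (sym (≡vᵇ⇒≡ _ z τx≡z)) τx≡swap)

module ShadowCompression (q : ℕ) {n : ℕ} (i j : Fin n) (F : Family n) where

  Δ Δτ : Family n
  Δ = shadow q F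
  Δτ = shadow q (τF q i j F)

  τ-shadow-of-fixed : ∀ {y z} → z ∈ box q n → T (F z) → T (F (τ i j z)) → y ⋖ z → T (Δ (τ i j y))
  τ-shadow-of-fixed {y} {z} z∈box Fz Fτz y⋖z with τ-cases i j y
  ... | inj₂ (_ , τy≡y) = subst (T ∘ Δ) (sym τy≡y) (shadow⁺ q F z∈box Fz y⋖z)
  ... | inj₁ (yᵢ<yⱼ , τy≡swap) = subst (T ∘ Δ) (sym τy≡swap) swap-y∈Δ
    where
    swap-y∈Δ : T (Δ (swap i j y))
    swap-y∈Δ with τ-cases i j z
    ... | inj₁ (_ , τz≡swap) =
      shadow⁺ q F (swap-∈-box q i j z∈box) (subst (T ∘ F) τz≡swap Fτz) (swap-⋖ i j y⋖z)
    ... | inj₂ (zⱼ≤zᵢ , _) = shadow⁺ q F z∈box Fz (swap-⋖-opposite i j y⋖z (<⇒≤ yᵢ<yⱼ) zⱼ≤zᵢ)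

  swap-shadow-of-moved : ∀ {x y} → x ∈ box q n → T (F x) → y ⋖ swap i j x → T (Δ (swap i j y))
  swap-shadow-of-moved {x} {y} x∈box Fx y⋖swap-x =
    shadow⁺ q F x∈box Fx (subst (swap i j y ⋖_) (swap-involutive i j x) (swap-⋖ i j y⋖swap-x))

  shadow-of-moved : ∀ {x y} → x ∈ box q n → T (F x) → lookup x i < lookup x j →
    y ⋖ swap i j x → lookup y i ≤ lookup y j → T (Δ y)
  shadow-of-moved {x} {y} x∈box Fx xᵢ<xⱼ y⋖swap-x yᵢ≤yⱼ = subst (T ∘ Δ) (swap-involutive i j y)
    (swap-shadow-of-moved x∈box Fx (swap-⋖-opposite i j y⋖swap-x yᵢ≤yⱼ swap-xⱼ≤swap-xᵢ))
    where
    swap-xⱼ≤swap-xᵢ : lookup (swap i j x) j ≤ lookup (swap i j x) i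
    swap-xⱼ≤swap-xᵢ = subst₂ _≤_ (sym (lookup-swap-j i j x)) (sym (lookup-swap-i i j x)) (<⇒≤ xᵢ<xⱼ)

  shadow-τF-cases : ∀ {y} → T (Δτ y) →
    (T (Δ y) × T (Δ (τ i j y))) ⊎ (¬ T (Δ y) × lookup y j < lookup y i × T (Δ (swap i j y)))
  shadow-τF-cases {y} h with z , z∈box , τFz , y⋖z ← shadow⁻ q (τF q i j F) {y} h with τF⁻ q i j F {z} τFz
  ... | inj₂ (Fz , Fτz) = inj₁ (shadow⁺ q F z∈box Fz y⋖z , τ-shadow-of-fixed z∈box Fz Fτz y⋖z)
  ... | inj₁ (x , x∈box , Fx , xᵢ<xⱼ , refl) with T? (Δ y)
  ...   | yes y∈Δ = inj₁ (y∈Δ , τ-elim (T ∘ Δ) i j {y} y∈Δ (swap-shadow-of-moved x∈box Fx y⋖z))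
  ...   | no y∉Δ = inj₂ (y∉Δ , ≰⇒> (y∉Δ ∘ shadow-of-moved x∈box Fx xᵢ<xⱼ y⋖z) ,
                          swap-shadow-of-moved x∈box Fx y⋖z)

  compress : Vec ℕ n → Vec ℕ n
  compress y = if Δ y then y else swap i j y

  compress-into : ∀ {y} → y ∈ box q n → T (Δτ y) → compress y ∈ box q n × T (Δ (compress y))
  compress-into {y} y∈box h with Δ y in e
  ... | true = y∈box , from T-≡ e
  ... | false with shadow-τF-cases {y} h
  ...   | inj₁ (y∈Δ , _) = ⊥-elim (subst T e y∈Δ)
  ...   | inj₂ (_ , _ , swap-y∈Δ) = swap-∈-box q i j y∈box , swap-y∈Δ

  compress-separates : ∀ {y w} → T (Δτ y) → T (Δτ w) → T (Δ y) → ¬ T (Δ w) → y ≢ swap i j w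
  compress-separates {w = w} hy hw y∈Δ w∉Δ refl
    with shadow-τF-cases {w} hw | shadow-τF-cases {swap i j w} hy
  ... | inj₁ (w∈Δ , _) | _ = w∉Δ w∈Δ
  ... | inj₂ _ | inj₂ (y∉Δ , _) = y∉Δ y∈Δ
  ... | inj₂ (_ , wⱼ<wᵢ , _) | inj₁ (_ , τy∈Δ) =
    w∉Δ (subst (T ∘ Δ) (trans (τ-swaps i j swap-wᵢ<swap-wⱼ) (swap-involutive i j w)) τy∈Δ)
    where
    swap-wᵢ<swap-wⱼ : lookup (swap i j w) i < lookup (swap i j w) j
    swap-wᵢ<swap-wⱼ = subst₂ _<_ (sym (lookup-swap-i i j w)) (sym (lookup-swap-j i j w)) wⱼ<wᵢ

  compress-injective : ∀ {y w} → y ∈ box q n → w ∈ box q n → T (Δτ y) → T (Δτ w) →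
    compress y ≡ compress w → y ≡ w
  compress-injective {y} {w} _ _ hy hw eq with Δ y in ey | Δ w in ew
  ... | true  | true  = eq
  ... | false | false = trans (sym (swap-involutive i j y)) (trans (cong (swap i j) eq) (swap-involutive i j w))
  ... | true  | false = ⊥-elim (compress-separates {y} {w} hy hw (from T-≡ ey) (subst T ew) eq)
  ... | false | true  = ⊥-elim (compress-separates {w} {y} hw hy (from T-≡ ew) (subst T ey) (sym eq))

  card-shadow-τF : card q Δτ ≤ card q Δ
  card-shadow-τF = filter-length-≤-injection _ _ (box-unique q n) compress compress-into compress-injective

excess : ℕ → ℕ → ℕ → ℕ
excess s a b = suc (a + b) ∸ s

∸-superadditive : ∀ a b s → (a ∸ s) + (b ∸ s) ≤ a + b ∸ s
∸-superadditive a b zero = ≤-refl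
∸-superadditive zero b (suc s) = ≤-refl
∸-superadditive (suc a) zero (suc s) =
  ≤-reflexive (trans (+-identityʳ (a ∸ s)) (cong (_∸ s) (sym (+-identityʳ a))))
∸-superadditive (suc a) (suc b) (suc s) =
  ≤-trans (∸-superadditive a b s) (∸-monoˡ-≤ s (+-monoʳ-≤ a (n≤1+n b)))

∸-increment-mono : ∀ s k {u v} → u ≤ v → (v ∸ s) + (u + k ∸ s) ≤ (u ∸ s) + (v + k ∸ s)
∸-increment-mono zero k {u} {v} _ = ≤-reflexive (x∙yz≈y∙xz v u k)
∸-increment-mono (suc s) k {zero} {v} _ = ∸-superadditive v k (suc s)
∸-increment-mono (suc s) k {suc u} {suc v} (s≤s u≤v) = ∸-increment-mono s k u≤v

excess-supermodular : ∀ s {a b c d} → a ≤ b → c ≤ d →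
  excess s a d + excess s b c ≤ excess s a c + excess s b d
excess-supermodular s {a} {b} {c} {d} a≤b c≤d = begin
  excess s a d + excess s b c                  ≡⟨ +-comm (excess s a d) (excess s b c) ⟩
  excess s b c + excess s a d                  ≡⟨ cong (λ m → excess s b c + (suc m ∸ s)) (extend a) ⟨
  (suc (b + c) ∸ s) + (suc (a + c) + k ∸ s)    ≤⟨ ∸-increment-mono s k (s≤s (+-monoˡ-≤ c a≤b)) ⟩
  (suc (a + c) ∸ s) + (suc (b + c) + k ∸ s)    ≡⟨ cong (λ m → excess s a c + (suc m ∸ s)) (extend b) ⟩
  excess s a c + excess s b d                  ∎
  where
  open ≤-Reasoning
  k = d ∸ c
  extend : ∀ x → x + c + k ≡ x + d
  extend x = trans (+-assoc x c k) (cong (x +_) (m+[n∸m]≡n c≤d))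

multisumInter-comm : (s : ℕ) (x y : Vec ℕ n) → multisumInter s x y ≡ multisumInter s y x
multisumInter-comm s x y = cong sum (zipWith-comm (λ a b → cong (λ m → suc m ∸ s) (+-comm a b)) x y)

multisumInter-swap : (s : ℕ) (i j : Fin n) (x y : Vec ℕ n) →
  multisumInter s (swap i j x) (swap i j y) ≡ multisumInter s x y
multisumInter-swap s i j x y =
  trans (cong sum (zipWith-swap (excess s) i j x y)) (sum-swap i j (zipWith (excess s) x y))

multisumInter-swap-mono : (s : ℕ) {i j : Fin n} (x y : Vec ℕ n) → i ≢ j →
  lookup x i ≤ lookup x j → lookup y j ≤ lookup y i → multisumInter s x y ≤ multisumInter s (swap i j x) y
multisumInter-swap-mono s {i} {j} x y i≢j xᵢ≤xⱼ yⱼ≤yᵢ = sum-mono-agreeOff₂ u w i≢j agree (begin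
  lookup u i + lookup u j          ≡⟨ cong₂ _+_ (lookup-zipWith _ i x y) (lookup-zipWith _ j x y) ⟩
  excess s xᵢ yᵢ + excess s xⱼ yⱼ  ≤⟨ excess-supermodular s xᵢ≤xⱼ yⱼ≤yᵢ ⟩
  excess s xᵢ yⱼ + excess s xⱼ yᵢ  ≡⟨ +-comm (excess s xᵢ yⱼ) (excess s xⱼ yᵢ) ⟩
  excess s xⱼ yᵢ + excess s xᵢ yⱼ  ≡⟨ cong₂ _+_ (w-at i (lookup-swap-i i j x)) (w-at j (lookup-swap-j i j x)) ⟨
  lookup w i + lookup w j          ∎)
  where
  open ≤-Reasoning
  u = zipWith (excess s) x y
  w = zipWith (excess s) (swap i j x) y
  xᵢ = lookup x i
  xⱼ = lookup x j
  yᵢ = lookup y i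
  yⱼ = lookup y j
  w-at : ∀ k {a} → lookup (swap i j x) k ≡ a → lookup w k ≡ excess s a (lookup y k)
  w-at k eq = trans (lookup-zipWith _ k (swap i j x) y) (cong (λ a → excess s a (lookup y k)) eq)
  agree : AgreeOff i j u w
  agree k k≢i k≢j = trans (lookup-zipWith _ k x y) (sym (w-at k (lookup-swap-≢ i j x k k≢i k≢j)))

module _ (q s t : ℕ) {n : ℕ} (i j : Fin n) (F : Family n) (F-int : MultisumIntersecting s t F) where

  private
    intersect : ∀ {x y} → T (F x) → T (F y) → t ≤ multisumInter s x y
    intersect {x} {y} Fx Fy = F-int x y (to T-≡ Fx) (to T-≡ Fy)

  intersect-moved-fixed : ∀ {x y} → T (F x) → lookup x i < lookup x j → T (F y) → T (F (τ i j y)) →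
    t ≤ multisumInter s (swap i j x) y
  intersect-moved-fixed {x} {y} Fx xᵢ<xⱼ Fy Fτy with τ-cases i j y
  ... | inj₁ (_ , τy≡swap) = begin
    t                                                    ≤⟨ intersect Fx (subst (T ∘ F) τy≡swap Fτy) ⟩
    multisumInter s x (swap i j y)                       ≡⟨ multisumInter-swap s i j x (swap i j y) ⟨
    multisumInter s (swap i j x) (swap i j (swap i j y)) ≡⟨ cong (multisumInter s (swap i j x)) (swap-involutive i j y) ⟩
    multisumInter s (swap i j x) y                       ∎
    where open ≤-Reasoning
  ... | inj₂ (yⱼ≤yᵢ , _) =
    ≤-trans (intersect Fx Fy) (multisumInter-swap-mono s x y i≢j (<⇒≤ xᵢ<xⱼ) yⱼ≤yᵢ)
    where
    i≢j : i ≢ j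
    i≢j refl = <-irrefl refl xᵢ<xⱼ

  τF-multisumIntersecting : MultisumIntersecting s t (τF q i j F)
  τF-multisumIntersecting z₁ z₂ h₁ h₂
    with τF⁻ q i j F {z₁} (from T-≡ h₁) | τF⁻ q i j F {z₂} (from T-≡ h₂)
  ... | inj₁ (x₁ , _ , Fx₁ , _ , refl) | inj₁ (x₂ , _ , Fx₂ , _ , refl) =
    subst (t ≤_) (sym (multisumInter-swap s i j x₁ x₂)) (intersect Fx₁ Fx₂)
  ... | inj₁ (x , _ , Fx , xᵢ<xⱼ , refl) | inj₂ (Fz₂ , Fτz₂) = intersect-moved-fixed Fx xᵢ<xⱼ Fz₂ Fτz₂
  ... | inj₂ (Fz₁ , Fτz₁) | inj₁ (x , _ , Fx , xᵢ<xⱼ , refl) =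
    subst (t ≤_) (multisumInter-comm s (swap i j x) z₁) (intersect-moved-fixed Fx xᵢ<xⱼ Fz₁ Fτz₁)
  ... | inj₂ (Fz₁ , _) | inj₂ (Fz₂ , _) = intersect Fz₁ Fz₂

lemma4p1 : (n q r s t : ℕ) → 1 ≤ n → 1 ≤ q → 1 ≤ r → 1 ≤ s → 1 ≤ t →
    (F : Family n) → F ⊆Q[ q , r ] → (i j : Fin n) →
    (card q (shadow q (τF q i j F)) ≤ card q (shadow q F))
    × (MultisumIntersecting s t F → MultisumIntersecting s t (τF q i j F))
lemma4p1 n q r s t _ _ _ _ _ F _ i j =
  ShadowCompression.card-shadow-τF q i j F , τF-multisumIntersecting q s t i j F
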